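{- Let $k\ge 1$ and let $a_1,\ldots,a_k,b_1,\ldots,b_k$ be real numbers, $A=a_1+\cdots+a_k$, $B=b_1+\cdots+b_k$. If $a_iB+b_iA\ne 0$ for all $i\in\{1,\ldots,k\}$, then $$\left(1-\sum_{i=1}^k\frac{a_ib_i}{a_iB+b_iA}\right)^2=\left(\sum_{i=1}^k\frac{a_i^2}{a_iB+b_iA}\right)\left(\sum_{i=1}^k\frac{b_i^2}{a_iB+b_iA}\right).$$ -}

module Defs where

open import Level using (Level; suc; _⊔_)
open import Data.Nat using (ℕ)
open import Data.Fin using (Fin)
open import Algebra.Bundles using (CommutativeRing)
open import Relation.Nullary using (¬_)
import Algebra.Definitions.RawMonoid as RM

record Field (c ℓ : Level) : Set (suc (c ⊔ ℓ)) where
  field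
    commutativeRing : CommutativeRing c ℓ
  open CommutativeRing commutativeRing public
  field
    0≉1     : ¬ (0# ≈ 1#)
    inv     : (x : Carrier) → ¬ (x ≈ 0#) → Carrier
    inv-law : (x : Carrier) (p : ¬ (x ≈ 0#)) → x * inv x p ≈ 1#

  ∑ : {n : ℕ} → (Fin n → Carrier) → Carrier
  ∑ = RM.sum +-rawMonoid

  div : Carrier → (y : Carrier) → ¬ (y ≈ 0#) → Carrier
  div x y p = x * inv y p

-- Put dᵢ = aᵢB + bᵢA, X = ∑ aᵢ²/dᵢ, Y = ∑ bᵢ²/dᵢ, Z = ∑ aᵢbᵢ/dᵢ and W = 1 − Z.
-- Summing aᵢ = (aᵢ²B + aᵢbᵢA)/dᵢ and bᵢ = (bᵢ²A + aᵢbᵢB)/dᵢ over i gives BX = AW and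
-- AY = BW, from which A(W² − XY) = 0 and B(W² − XY) = 0. Hence d₁(W² − XY) = 0,
-- and W² = XY because d₁ ≠ 0.
module Submission where

open import Defs
open import Level using (Level)
open import Data.Nat using (ℕ; _≤_; s≤s)
open import Data.Fin using (Fin; zero)
open import Data.Maybe using (nothing)
open import Relation.Nullary using (¬_)
open import Algebra.Bundles using (CommutativeRing)
import Algebra.Properties.CommutativeSemigroup as CommutativeSemigroupProperties
import Algebra.Properties.Ring as RingProperties
import Algebra.Properties.Semiring.Sum as SemiringSum
import Algebra.Solver.Ring
import Algebra.Solver.Ring.AlmostCommutativeRing as AlmostCommutativeRing
import Relation.Binary.Reasoning.Setoid as SetoidReasoning

module CommutativeRingProperties {c ℓ : Level} (R : CommutativeRing c ℓ) where
  open CommutativeRing R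
  open CommutativeSemigroupProperties *-commutativeSemigroup using (x∙yz≈y∙xz; x∙yz≈z∙yx)
  open RingProperties ring using (x[y-z]≈xy-xz)
  open SemiringSum semiring using (sum; *-distribˡ-sum; ∑-distrib-+)
  open SetoidReasoning setoid

  private
    R′ = AlmostCommutativeRing.fromCommutativeRing R
    open Algebra.Solver.Ring (AlmostCommutativeRing.AlmostCommutativeRing.rawRing R′) R′
      (AlmostCommutativeRing.-raw-almostCommutative⟶ R′) (λ _ _ → nothing)

  B[xxe]+A[xye]≈x : ∀ {A B x y e} → (x * B + y * A) * e ≈ 1# →
                    B * (x * x * e) + A * (x * y * e) ≈ x
  B[xxe]+A[xye]≈x {A} {B} {x} {y} {e} [xB+yA]e≈1 = begin
    B * (x * x * e) + A * (x * y * e)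
      ≈⟨ solve 5 (λ A B x y e → B :* (x :* x :* e) :+ A :* (x :* y :* e)
                                  := x :* ((x :* B :+ y :* A) :* e)) refl A B x y e ⟩
    x * ((x * B + y * A) * e) ≈⟨ *-congˡ [xB+yA]e≈1 ⟩
    x * 1#                    ≈⟨ *-identityʳ x ⟩
    x                         ∎

  A[yye]+B[xye]≈y : ∀ {A B x y e} → (x * B + y * A) * e ≈ 1# →
                    A * (y * y * e) + B * (x * y * e) ≈ y
  A[yye]+B[xye]≈y {A} {B} {x} {y} {e} [xB+yA]e≈1 = begin
    A * (y * y * e) + B * (x * y * e)
      ≈⟨ solve 5 (λ A B x y e → A :* (y :* y :* e) :+ B :* (x :* y :* e)
                                  := y :* ((x :* B :+ y :* A) :* e)) refl A B x y e ⟩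
    y * ((x * B + y * A) * e) ≈⟨ *-congˡ [xB+yA]e≈1 ⟩
    y * 1#                    ≈⟨ *-identityʳ y ⟩
    y                         ∎

  sum-linear : ∀ {n} u v (f g : Fin n → Carrier) →
               u * sum f + v * sum g ≈ sum (λ i → u * f i + v * g i)
  sum-linear u v f g = begin
    u * sum f + v * sum g                         ≈⟨ +-cong (*-distribˡ-sum u f) (*-distribˡ-sum v g) ⟩
    sum (λ i → u * f i) + sum (λ i → v * g i)     ≈⟨ ∑-distrib-+ (λ i → u * f i) (λ i → v * g i) ⟨
    sum (λ i → u * f i + v * g i)                 ∎

  x+yz≈y⇒x≈y[1-z] : ∀ {x y z} → x + y * z ≈ y → x ≈ y * (1# - z)
  x+yz≈y⇒x≈y[1-z] {x} {y} {z} x+yz≈y = begin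
    x                   ≈⟨ +-identityʳ x ⟨
    x + 0#              ≈⟨ +-congˡ (-‿inverseʳ (y * z)) ⟨
    x + (y * z - y * z) ≈⟨ +-assoc x (y * z) (- (y * z)) ⟨
    (x + y * z) - y * z ≈⟨ +-congʳ x+yz≈y ⟩
    y - y * z           ≈⟨ +-congʳ (*-identityʳ y) ⟨
    y * 1# - y * z      ≈⟨ x[y-z]≈xy-xz y 1# z ⟨
    y * (1# - z)        ∎

  BX≈AW⇒AY≈BW⇒A[WW]≈A[XY] : ∀ {A B W X Y} → B * X ≈ A * W → A * Y ≈ B * W →
                            A * (W * W) ≈ A * (X * Y)
  BX≈AW⇒AY≈BW⇒A[WW]≈A[XY] {A} {B} {W} {X} {Y} BX≈AW AY≈BW = begin
    A * (W * W) ≈⟨ x∙yz≈y∙xz A W W ⟩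
    W * (A * W) ≈⟨ *-congˡ BX≈AW ⟨
    W * (B * X) ≈⟨ x∙yz≈z∙yx W B X ⟩
    X * (B * W) ≈⟨ *-congˡ AY≈BW ⟨
    X * (A * Y) ≈⟨ x∙yz≈y∙xz X A Y ⟩
    A * (X * Y) ∎

  *-congˡ-linear-combination : ∀ {A B P Q} u v → B * P ≈ B * Q → A * P ≈ A * Q →
                               (u * B + v * A) * P ≈ (u * B + v * A) * Q
  *-congˡ-linear-combination {A} {B} {P} {Q} u v BP≈BQ AP≈AQ = begin
    (u * B + v * A) * P         ≈⟨ distribʳ P (u * B) (v * A) ⟩
    u * B * P + v * A * P       ≈⟨ +-cong (*-assoc u B P) (*-assoc v A P) ⟩
    u * (B * P) + v * (A * P)   ≈⟨ +-cong (*-congˡ BP≈BQ) (*-congˡ AP≈AQ) ⟩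
    u * (B * Q) + v * (A * Q)   ≈⟨ +-cong (*-assoc u B Q) (*-assoc v A Q) ⟨
    u * B * Q + v * A * Q       ≈⟨ distribʳ Q (u * B) (v * A) ⟨
    (u * B + v * A) * Q         ∎

module FieldProperties {c ℓ : Level} (F : Field c ℓ) where
  open Field F
  open CommutativeSemigroupProperties *-commutativeSemigroup using (xy∙z≈y∙xz)
  open SetoidReasoning setoid

  *-cancelˡ-≉0 : ∀ {d x y} (d≉0 : ¬ d ≈ 0#) → d * x ≈ d * y → x ≈ y
  *-cancelˡ-≉0 {d} {x} {y} d≉0 dx≈dy = begin
    x             ≈⟨ z≈d⁻¹[dz] x ⟩
    d⁻¹ * (d * x) ≈⟨ *-congˡ dx≈dy ⟩
    d⁻¹ * (d * y) ≈⟨ z≈d⁻¹[dz] y ⟨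
    y             ∎
    where
    d⁻¹ = inv d d≉0
    z≈d⁻¹[dz] : ∀ z → z ≈ d⁻¹ * (d * z)
    z≈d⁻¹[dz] z = begin
      z             ≈⟨ *-identityˡ z ⟨
      1# * z        ≈⟨ *-congʳ (inv-law d d≉0) ⟨
      d * d⁻¹ * z   ≈⟨ xy∙z≈y∙xz d d⁻¹ z ⟩
      d⁻¹ * (d * z) ∎

lemma2p1 : {c ℓ : Level} (F : Field c ℓ) → let open Field F in
    (k : ℕ) → 1 ≤ k → (a b : Fin k → Carrier) →
    (h : (i : Fin k) → ¬ ((a i * ∑ b) + (b i * ∑ a) ≈ 0#)) →
    (1# - ∑ (λ i → div (a i * b i) ((a i * ∑ b) + (b i * ∑ a)) (h i)))
      * (1# - ∑ (λ i → div (a i * b i) ((a i * ∑ b) + (b i * ∑ a)) (h i)))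
    ≈ ∑ (λ i → div (a i * a i) ((a i * ∑ b) + (b i * ∑ a)) (h i))
      * ∑ (λ i → div (b i * b i) ((a i * ∑ b) + (b i * ∑ a)) (h i))
lemma2p1 F _ (s≤s _) a b h =
  *-cancelˡ-≉0 (h zero) (*-congˡ-linear-combination (a zero) (b zero) B[WW]≈B[XY] A[WW]≈A[XY])
  where
  open Field F hiding (zero)
  open CommutativeRingProperties commutativeRing
  open FieldProperties F
  open SemiringSum semiring using (sum-cong-≋)

  A B : Carrier
  A = ∑ a
  B = ∑ b

  1/d aa/d ab/d bb/d : Fin _ → Carrier
  1/d i = inv (a i * B + b i * A) (h i)
  aa/d i = a i * a i * 1/d i
  ab/d i = a i * b i * 1/d i
  bb/d i = b i * b i * 1/d i

  X Y W : Carrier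
  X = ∑ aa/d
  Y = ∑ bb/d
  W = 1# - ∑ ab/d

  BX≈AW : B * X ≈ A * W
  BX≈AW = x+yz≈y⇒x≈y[1-z]
    (trans (sum-linear B A aa/d ab/d) (sum-cong-≋ (λ i → B[xxe]+A[xye]≈x (inv-law _ (h i)))))

  AY≈BW : A * Y ≈ B * W
  AY≈BW = x+yz≈y⇒x≈y[1-z]
    (trans (sum-linear A B bb/d ab/d) (sum-cong-≋ (λ i → A[yye]+B[xye]≈y (inv-law _ (h i)))))

  A[WW]≈A[XY] : A * (W * W) ≈ A * (X * Y)
  A[WW]≈A[XY] = BX≈AW⇒AY≈BW⇒A[WW]≈A[XY] BX≈AW AY≈BW

  B[WW]≈B[XY] : B * (W * W) ≈ B * (X * Y)
  B[WW]≈B[XY] = trans (BX≈AW⇒AY≈BW⇒A[WW]≈A[XY] AY≈BW BX≈AW) (*-congˡ (*-comm Y X))
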